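{- Let $r,q,a,b$ be integers, all greater than $1$, with $q-1=ab$. Let $P=\{1,2,\dots,rq\}$ be partitioned into $r$ groups $G_1,\dots,G_r$, each of size $q$. For each $j\in\{1,\dots,r\}$ let $\mathcal{P}_j=\{P_{j1},\dots,P_{jq}\}$ be a family of $q$ subsets of $G_j$ of size $a$ such that every point of $G_j$ lies in exactly $a$ of them, and put $B_i=P_{1i}\cup\cdots\cup P_{ri}$ for $i=1,\dots,q$. For each $g\in P$, with $g\in G_h$, fix a partition $G_h\setminus\{g\}=X_{g1}\cup\cdots\cup X_{gb}$ with $|X_{gl}|=a$ for all $l$, and define $B_{gl,j}=X_{gl}\cup(B_j\setminus P_{hj})$ for $1\le l\le b$, $1\le j\le q$; let $\mathcal{B}_g=\{B_{gl,j}:1\le l\le b,\ 1\le j\le q\}$. Let $D$ be the directed graph whose vertex set is $\{(g,B): g\in P,\ B\in\mathcal{B}_g\}$ (i.e. the pairs $(g,B_{gl,j})$ for $g\in P$, $1\le l\le b$, $1\le j\le q$), with an arc $(g,B)\to(g',B')$ if and only if $g\in B'$. Then $D$ is a directed strongly regular graph with parameters \[(v,k,t,\lambda,\mu)=\Big(\tfrac{rq^2(q-1)}{a},\ rq(q-1),\ r(q-1)a+a,\ q(a-1)+(r-1)(q-1)a,\ r(q-1)a+a\Big).\]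
   Context: A directed strongly regular graph with parameters $(v,k,t,\lambda,\mu)$ is a loopless directed graph on $v$ vertices with adjacency matrix $A$ satisfying $AJ=JA=kJ$ and $A^2=tI+\lambda A+\mu(J-I-A)$, where $I$ is the identity and $J$ the all-ones matrix. Equivalently: every vertex has in- and out-degree $k$; every vertex $x$ has exactly $t$ out-neighbours that are also in-neighbours of $x$; and for distinct vertices $x,y$ the number of directed paths of length two from $x$ to $y$ is $\lambda$ if $x\to y$ is an arc and $\mu$ otherwise. -}

module Defs where

open import Data.Nat using (ℕ; zero; suc; _+_)
open import Data.Bool using (Bool; true; false; if_then_else_; _∧_)
open import Data.Fin using (Fin; zero; suc; remQuot; _≟_)
open import Data.Fin.Subset using (Subset; _∪_; _─_; _-_; ⋃)
open import Data.Vec using (lookup; tabulate)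
open import Data.List using (map)
open import Data.List.Base using (allFin)
open import Data.Product using (_,_; proj₁; proj₂)
open import Relation.Binary.PropositionalEquality using (_≡_)
open import Relation.Nullary using (¬_)
open import Relation.Nullary.Decidable using (⌊_⌋)

count : ∀ {n} → (Fin n → Bool) → ℕ
count {zero} p = 0
count {suc n} p = (if p zero then 1 else 0) + count (λ i → p (suc i))

-- The fields are the
-- entrywise reading of AJ = JA = kJ and A² = tI + λA + μ(J - I - A).
record IsDSRG (n : ℕ) (A : Fin n → Fin n → Bool) (v k t lam mu : ℕ) : Set where
  field
    order       : n ≡ v
    loopless    : ∀ x → A x x ≡ false
    outDegree   : ∀ x → count (λ y → A x y) ≡ k
    inDegree    : ∀ y → count (λ x → A x y) ≡ k
    diagonal    : ∀ x → count (λ z → A x z ∧ A z x) ≡ t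
    adjacent    : ∀ x y → ¬ x ≡ y → A x y ≡ true  → count (λ z → A x z ∧ A z y) ≡ lam
    nonadjacent : ∀ x y → ¬ x ≡ y → A x y ≡ false → count (λ z → A x z ∧ A z y) ≡ mu

groupOf : ∀ {m r} → (Fin m → Fin r) → Fin r → Subset m
groupOf grp h = tabulate (λ x → ⌊ grp x ≟ h ⌋)

blockB : ∀ {m r q} → (Fin r → Fin q → Subset m) → Fin q → Subset m
blockB {r = r} P i = ⋃ (map (λ h → P h i) (allFin r))

blockBg : ∀ {m r q b} → (Fin m → Fin r) → (Fin r → Fin q → Subset m)
          → (Fin m → Fin b → Subset m) → Fin m → Fin b → Fin q → Subset m
blockBg grp P X g l j = X g l ∪ (blockB P j ─ P (grp g) j)

-- Vertices (g, B_{gl,j}) encoded as Fin (m * (b * q)) via remQuot: w ↦ (g , (l , j)).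
-- Arc (g,B) → (g',B') iff g ∈ B'.
arcD : ∀ {m r q b} → (Fin m → Fin r) → (Fin r → Fin q → Subset m)
       → (Fin m → Fin b → Subset m)
       → Fin (m Data.Nat.* (b Data.Nat.* q)) → Fin (m Data.Nat.* (b Data.Nat.* q)) → Bool
arcD {m} {r} {q} {b} grp P X w w' =
  let g  = proj₁ (remQuot {m} (b Data.Nat.* q) w)
      g' = proj₁ (remQuot {m} (b Data.Nat.* q) w')
      l' = proj₁ (remQuot {b} q (proj₂ (remQuot {m} (b Data.Nat.* q) w')))
      j' = proj₂ (remQuot {b} q (proj₂ (remQuot {m} (b Data.Nat.* q) w')))
  in lookup (blockBg grp P X g' l' j') g

module Submission where

-- A vertex w of D is a pair (g , B_{gl,j}); write point w = g and block w = B_{gl,j}, so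
-- that w → w′ is an arc iff point w ∈ block w′.  Counting 2-paths x → z → y over the
-- vertices z = (p , B_{pl,j}) groups them by the point p, and the contribution of p is
--   [p ∈ block y] · N(point x , p),   N(g , p) = #{(l , j) : g ∈ B_{pl,j}}.
-- The whole proof rests on two facts about the construction:
--   * N(g , p) is 0 if p = g, q if p ≠ g lies in the group of g, and ba otherwise;
--   * every block B_{gl,j} meets every group in exactly a points (so has ra points).
-- Hence the number of 2-paths from x to y is
--   q·(a − [point x ∈ block y]) + ba·(ra − a),
-- which gives λ and μ (and t, since D is loopless), while the same weighted sum with
-- every point counted gives the out-degree, and the in-degree is bq·|block y| = bq·ra.

open import Defs
open import Data.Nat using (ℕ; _+_; _*_; _∸_; _^_; _<_; NonZero; _/_)
open import Data.Bool using (Bool; true; false)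
open import Data.Fin using (Fin)
open import Data.Fin.Subset using (Subset; ∣_∣; _∈_; _⊆_; _∩_; _-_; ⊥)
open import Data.Vec using (lookup)
open import Data.Product using (∃-syntax)
open import Relation.Binary.PropositionalEquality using (_≡_)
open import Relation.Nullary using (¬_)

open import Data.Nat using (zero; suc)
open import Data.Nat.Properties
  using (+-*-semiring; +-assoc; +-identityʳ; *-assoc; *-zeroʳ; *-identityʳ; m+n∸m≡n; <⇒≤)
open import Data.Nat.DivMod using (m*n/n≡m)
open import Data.Nat.Tactic.RingSolver using (solve-∀)
open import Data.Bool using (_∧_; _∨_; not; if_then_else_)
open import Data.Bool.Properties
  using (∧-identityʳ; ∧-zeroʳ; ∧-inverseʳ; ∧-conicalˡ; ∧-conicalʳ; ∨-identityʳ; ¬-not; T-≡)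
open import Data.Fin using (zero; suc; combine; remQuot; _≟_; _↑ˡ_; _↑ʳ_)
open import Data.Fin.Properties using (remQuot-combine; punchInᵢ≢i)
open import Data.Fin.Subset using (_─_; ⁅_⁆; ⋃)
open import Data.Fin.Subset.Properties using (x∈⁅x⁆)
open import Data.Vec using ([]; _∷_)
open import Data.Vec.Properties
  using ([]=⇒lookup; lookup⇒[]=; lookup∘tabulate; lookup-zipWith; lookup-replicate)
open import Data.Vec.Functional using (removeAt)
open import Data.List using (List; []; _∷_; map; allFin)
open import Data.Bool.ListAction using (any)
open import Data.List.Membership.Propositional using (lose) renaming (_∈_ to _∈ₗ_)
open import Data.List.Membership.Propositional.Properties using (∈-allFin)
open import Data.List.Relation.Unary.Any.Properties using (any⁺)
open import Data.Product using (_×_; _,_; proj₁; proj₂)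
open import Function using (_∘_; module Equivalence)
open import Relation.Binary.PropositionalEquality using (refl; sym; trans; cong; cong₂; module ≡-Reasoning)
open import Relation.Nullary using (yes; no; contradiction)
open import Relation.Nullary.Decidable using (⌊_⌋; dec-true; dec-false; isYes≗does; toWitness)
open import Algebra.Properties.Semiring.Sum +-*-semiring
  using (sum; sum-syntax; sum-cong-≗; sum-remove; sum-replicate-zero; ∑-distrib-+; ∑-comm; *-distribˡ-sum)

open ≡-Reasoning

χ : Bool → ℕ
χ b = if b then 1 else 0

≟⇒≡ : ∀ {n} {x y : Fin n} → ⌊ x ≟ y ⌋ ≡ true → x ≡ y
≟⇒≡ {x = x} {y} e = toWitness {a? = x ≟ y} (Equivalence.from T-≡ e)

≡⇒≟ : ∀ {n} {x y : Fin n} → x ≡ y → ⌊ x ≟ y ⌋ ≡ true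
≡⇒≟ {x = x} {y} e = trans (isYes≗does (x ≟ y)) (dec-true (x ≟ y) e)

≢⇒≟ : ∀ {n} {x y : Fin n} → ¬ x ≡ y → ⌊ x ≟ y ⌋ ≡ false
≢⇒≟ {x = x} {y} ne = trans (isYes≗does (x ≟ y)) (dec-false (x ≟ y) ne)

⊆⇒lookup : ∀ {n} {S T : Subset n} {x} → S ⊆ T → lookup S x ≡ true → lookup T x ≡ true
⊆⇒lookup {S = S} {x = x} S⊆T e = []=⇒lookup (S⊆T (lookup⇒[]= x S e))

lookup-─ : ∀ {n} (S T : Subset n) x → lookup (S ─ T) x ≡ lookup S x ∧ not (lookup T x)
lookup-─ (s ∷ S) (true ∷ T)  zero    = sym (∧-zeroʳ s)
lookup-─ (s ∷ S) (false ∷ T) zero    = sym (∧-identityʳ s)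
lookup-─ (_ ∷ S) (_ ∷ T)     (suc x) = lookup-─ S T x

lookup-⋃ : ∀ {n} {A : Set} (f : A → Subset n) (as : List A) x →
           lookup (⋃ (map f as)) x ≡ any (λ α → lookup (f α) x) as
lookup-⋃ f []       x = lookup-replicate x false
lookup-⋃ f (α ∷ as) x =
  trans (lookup-zipWith _∨_ x (f α) _) (cong (lookup (f α) x ∨_) (lookup-⋃ f as x))

any-true : ∀ {A : Set} (p : A → Bool) {α as} → α ∈ₗ as → p α ≡ true → any p as ≡ true
any-true p α∈as e = Equivalence.to T-≡ (any⁺ p (lose α∈as (Equivalence.from T-≡ e)))

any-false : ∀ {A : Set} (p : A → Bool) as → (∀ α → p α ≡ false) → any p as ≡ false
any-false p []       _    = refl
any-false p (α ∷ as) none rewrite none α = any-false p as none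

sum-const : ∀ n c → sum {n} (λ _ → c) ≡ n * c
sum-const zero    c = refl
sum-const (suc n) c = cong (c +_) (sum-const n c)

sum-point : ∀ {n} (f : Fin n → ℕ) i → (∀ j → ¬ j ≡ i → f j ≡ 0) → sum f ≡ f i
sum-point {suc n} f i vanish = begin
  sum f                     ≡⟨ sum-remove {i = i} f ⟩
  f i + sum (removeAt f i)  ≡⟨ cong (f i +_) rest ⟩
  f i + 0                   ≡⟨ +-identityʳ (f i) ⟩
  f i                       ∎
  where
  rest : sum (removeAt f i) ≡ 0
  rest = trans (sum-cong-≗ (λ k → vanish _ (punchInᵢ≢i i k))) (sum-replicate-zero n)

sum-++ : ∀ {m n} (f : Fin (m + n) → ℕ) →
         sum f ≡ ∑[ i < m ] f (i ↑ˡ n) + ∑[ j < n ] f (m ↑ʳ j)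
sum-++ {zero}      f = refl
sum-++ {suc m} {n} f =
  trans (cong (f zero +_) (sum-++ {m} {n} (f ∘ suc))) (sym (+-assoc (f zero) _ _))

sum-combine : ∀ {m n} (f : Fin (m * n) → ℕ) → sum f ≡ ∑[ i < m ] ∑[ j < n ] f (combine i j)
sum-combine {zero}      f = refl
sum-combine {suc m} {n} f =
  trans (sum-++ {n} {m * n} f)
        (cong (∑[ j < n ] f (j ↑ˡ (m * n)) +_) (sum-combine {m} {n} (λ k → f (n ↑ʳ k))))

count≡sum : ∀ {n} (p : Fin n → Bool) → count p ≡ sum (χ ∘ p)
count≡sum {zero}  p = refl
count≡sum {suc n} p = cong (χ (p zero) +_) (count≡sum (p ∘ suc))

count-cong : ∀ {n} {p p′ : Fin n → Bool} → (∀ i → p i ≡ p′ i) → count p ≡ count p′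
count-cong {zero}  _ = refl
count-cong {suc n} e = cong₂ _+_ (cong χ (e zero)) (count-cong (e ∘ suc))

count-none : ∀ {n} (p : Fin n → Bool) → (∀ i → p i ≡ false) → count p ≡ 0
count-none {zero}  p _    = refl
count-none {suc n} p none rewrite none zero = count-none (p ∘ suc) (none ∘ suc)

count-const : ∀ n c → count {n} (λ _ → c) ≡ n * χ c
count-const n c = trans (count≡sum {n} (λ _ → c)) (sum-const n (χ c))

count-point : ∀ {n} (p : Fin n → Bool) i → (∀ j → ¬ j ≡ i → p j ≡ false) → count p ≡ χ (p i)
count-point p i only = trans (count≡sum p) (sum-point (χ ∘ p) i (λ j ne → cong χ (only j ne)))

count-∧-const : ∀ {n} (p : Fin n → Bool) c → count (λ i → p i ∧ c) ≡ χ c * count p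
count-∧-const p true  = trans (count-cong (∧-identityʳ ∘ p)) (sym (+-identityʳ _))
count-∧-const p false = count-none _ (∧-zeroʳ ∘ p)

count-split : ∀ {n} (p c : Fin n → Bool) →
              count p ≡ count (λ i → p i ∧ c i) + count (λ i → p i ∧ not (c i))
count-split {n} p c = begin
  count p                                                       ≡⟨ count≡sum p ⟩
  sum (χ ∘ p)                                                   ≡⟨ sum-cong-≗ split ⟩
  ∑[ i < n ] (χ (p i ∧ c i) + χ (p i ∧ not (c i)))             ≡⟨ ∑-distrib-+ {n} _ _ ⟩
  ∑[ i < n ] χ (p i ∧ c i) + ∑[ i < n ] χ (p i ∧ not (c i))     ≡⟨ sym (cong₂ _+_ (count≡sum (λ i → p i ∧ c i)) (count≡sum (λ i → p i ∧ not (c i)))) ⟩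
  count (λ i → p i ∧ c i) + count (λ i → p i ∧ not (c i))       ∎
  where
  split : ∀ i → χ (p i) ≡ χ (p i ∧ c i) + χ (p i ∧ not (c i))
  split i with p i | c i
  ... | true  | true  = refl
  ... | true  | false = refl
  ... | false | _     = refl

count-fibres : ∀ {n k} (π : Fin n → Fin k) (p : Fin n → Bool) →
               count p ≡ ∑[ h < k ] count (λ x → p x ∧ ⌊ π x ≟ h ⌋)
count-fibres {n} {k} π p = begin
  count p                                                ≡⟨ count≡sum p ⟩
  sum (χ ∘ p)                                            ≡⟨ sum-cong-≗ fibre ⟩
  ∑[ x < n ] ∑[ h < k ] χ (p x ∧ ⌊ π x ≟ h ⌋)            ≡⟨ ∑-comm {n} {k} _ ⟩
  ∑[ h < k ] ∑[ x < n ] χ (p x ∧ ⌊ π x ≟ h ⌋)            ≡⟨ sum-cong-≗ {k} (λ h → sym (count≡sum (λ x → p x ∧ ⌊ π x ≟ h ⌋))) ⟩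
  ∑[ h < k ] count (λ x → p x ∧ ⌊ π x ≟ h ⌋)              ∎
  where
  fibre : ∀ x → χ (p x) ≡ ∑[ h < k ] χ (p x ∧ ⌊ π x ≟ h ⌋)
  fibre x = sym (trans
    (sum-point _ (π x) (λ h ne → cong χ (trans (cong (p x ∧_) (≢⇒≟ (ne ∘ sym))) (∧-zeroʳ (p x)))))
    (cong χ (trans (cong (p x ∧_) (≡⇒≟ refl)) (∧-identityʳ (p x)))))

count-sum-const : ∀ {k} n (f : Fin k → Bool) → ∑[ l < k ] count {n} (λ _ → f l) ≡ n * count f
count-sum-const {k} n f = begin
  ∑[ l < k ] count {n} (λ _ → f l)   ≡⟨ sum-cong-≗ (λ l → count-const n (f l)) ⟩
  ∑[ l < k ] (n * χ (f l))           ≡⟨ sym (*-distribˡ-sum n (χ ∘ f)) ⟩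
  n * sum (χ ∘ f)                    ≡⟨ cong (n *_) (sym (count≡sum f)) ⟩
  n * count f                        ∎

card≡count : ∀ {n} (S : Subset n) → ∣ S ∣ ≡ count (lookup S)
card≡count []          = refl
card≡count (true ∷ S)  = cong suc (card≡count S)
card≡count (false ∷ S) = card≡count S

order-arith : ∀ r q a b .{{_ : NonZero a}} → q ∸ 1 ≡ a * b →
              r * q * (b * q) ≡ (r * q ^ 2 * (q ∸ 1)) / a
order-arith r q a b q-1≡ab rewrite q-1≡ab =
  trans (sym (m*n/n≡m (r * q * (b * q)) a)) (cong (_/ a) (identity r q a b))
  where
  identity : ∀ r q a b → r * q * (b * q) * a ≡ r * (q * (q * 1)) * (a * b)
  identity = solve-∀

out-degree-arith : ∀ r q a b → 0 < r → 0 < q → q ∸ 1 ≡ a * b →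
                   q * (q ∸ 1) + b * a * (r * q ∸ q) ≡ r * q * (q ∸ 1)
out-degree-arith (suc R) (suc Q) a b _ _ refl rewrite m+n∸m≡n (suc (a * b)) (R * suc (a * b)) =
  identity R a b
  where
  identity : ∀ R a b → suc (a * b) * (a * b) + b * a * (R * suc (a * b)) ≡ suc R * suc (a * b) * (a * b)
  identity = solve-∀

in-degree-arith : ∀ r q a b → q ∸ 1 ≡ a * b → b * q * (r * a) ≡ r * q * (q ∸ 1)
in-degree-arith r q a b q-1≡ab rewrite q-1≡ab = identity r q a b
  where
  identity : ∀ r q a b → b * q * (r * a) ≡ r * q * (a * b)
  identity = solve-∀

adjacent-arith : ∀ r q a b → 0 < r → q ∸ 1 ≡ a * b →
                 q * (a ∸ 1) + b * a * (r * a ∸ a) ≡ q * (a ∸ 1) + (r ∸ 1) * (q ∸ 1) * a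
adjacent-arith (suc R) q a b _ q-1≡ab rewrite q-1≡ab | m+n∸m≡n a (R * a) =
  cong (q * (a ∸ 1) +_) (identity R a b)
  where
  identity : ∀ R a b → b * a * (R * a) ≡ R * (a * b) * a
  identity = solve-∀

nonadjacent-arith : ∀ r q a b → 0 < r → 0 < q → q ∸ 1 ≡ a * b →
                    q * a + b * a * (r * a ∸ a) ≡ r * (q ∸ 1) * a + a
nonadjacent-arith (suc R) (suc Q) a b _ _ refl rewrite m+n∸m≡n a (R * a) = identity R a b
  where
  identity : ∀ R a b → suc (a * b) * a + b * a * (R * a) ≡ suc R * (a * b) * a + a
  identity = solve-∀

module Construction {m r q b : ℕ} (grp : Fin m → Fin r)
                    (P : Fin r → Fin q → Subset m) (X : Fin m → Fin b → Subset m) where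

  inGroup : Fin r → Fin m → Bool
  inGroup h x = ⌊ grp x ≟ h ⌋

  lookup-groupOf : ∀ h x → lookup (groupOf grp h) x ≡ inGroup h x
  lookup-groupOf h x = lookup∘tabulate (λ x → ⌊ grp x ≟ h ⌋) x

  ∈group : ∀ {h x} → grp x ≡ h → x ∈ groupOf grp h
  ∈group {h} {x} e = lookup⇒[]= x (groupOf grp h) (trans (lookup-groupOf h x) (≡⇒≟ e))

  count-within-group : ∀ (S T : Fin m → Bool) h →
    (∀ x → grp x ≡ h → S x ≡ T x) → (∀ x → ¬ grp x ≡ h → T x ≡ false) →
    count (λ x → S x ∧ inGroup h x) ≡ count T
  count-within-group S T h agree outside = count-cong restrict
    where
    restrict : ∀ x → S x ∧ inGroup h x ≡ T x
    restrict x with grp x ≟ h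
    ... | yes e  = trans (∧-identityʳ (S x)) (agree x e)
    ... | no  ne = trans (∧-zeroʳ (S x)) (sym (outside x ne))

  inGroupOf nearby elsewhere : (Fin m → Bool) → Fin m → Fin m → Bool
  inGroupOf S g p = S p ∧ inGroup (grp g) p
  nearby S g p = inGroupOf S g p ∧ not ⌊ p ≟ g ⌋
  elsewhere S g p = S p ∧ not (inGroup (grp g) p)

  point-in-group : ∀ S g → count (inGroupOf S g) ≡ χ (S g) + count (nearby S g)
  point-in-group S g = begin
    count (inGroupOf S g)                                      ≡⟨ count-split (inGroupOf S g) isG ⟩
    count (λ p → inGroupOf S g p ∧ isG p) + count (nearby S g) ≡⟨ cong (_+ count (nearby S g)) onlyG ⟩
    χ (S g) + count (nearby S g)                               ∎
    where
    isG : Fin m → Bool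
    isG p = ⌊ p ≟ g ⌋
    atG : inGroupOf S g g ∧ isG g ≡ S g
    atG = trans (cong₂ (λ u v → (S g ∧ u) ∧ v) (≡⇒≟ refl) (≡⇒≟ refl))
                (trans (∧-identityʳ _) (∧-identityʳ _))
    onlyG : count (λ p → inGroupOf S g p ∧ isG p) ≡ χ (S g)
    onlyG = trans (count-point (λ p → inGroupOf S g p ∧ isG p) g
                    (λ p ne → trans (cong (inGroupOf S g p ∧_) (≢⇒≟ ne)) (∧-zeroʳ _)))
                  (cong χ atG)

  B : Fin m → Fin b → Fin q → Subset m
  B = blockBg grp P X

  incidences : Fin m → Fin m → ℕ
  incidences g p = ∑[ l < b ] count (λ j → lookup (B p l j) g)

  Vertex : Set
  Vertex = Fin (m * (b * q))

  vertex : Fin m → Fin b → Fin q → Vertex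
  vertex g l j = combine g (combine l j)

  point : Vertex → Fin m
  point w = proj₁ (remQuot {m} (b * q) w)

  label : Vertex → Fin b × Fin q
  label w = remQuot {b} q (proj₂ (remQuot {m} (b * q) w))

  block : Vertex → Subset m
  block w = B (point w) (proj₁ (label w)) (proj₂ (label w))

  -- By definition, arc w w′ = lookup (block w′) (point w).
  arc : Vertex → Vertex → Bool
  arc = arcD grp P X

  point-vertex : ∀ g l j → point (vertex g l j) ≡ g
  point-vertex g l j = cong proj₁ (remQuot-combine g (combine l j))

  block-vertex : ∀ g l j → block (vertex g l j) ≡ B g l j
  block-vertex g l j =
    trans (cong (λ { (g′ , u) → B g′ (proj₁ (remQuot {b} q u)) (proj₂ (remQuot {b} q u)) })
                (remQuot-combine g (combine l j)))
          (cong (λ { (l′ , j′) → B g l′ j′ }) (remQuot-combine l j))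

  count-vertices : ∀ (F : Vertex → Bool) →
                   count F ≡ ∑[ g < m ] ∑[ l < b ] count (λ j → F (vertex g l j))
  count-vertices F = begin
    count F                                                          ≡⟨ count≡sum F ⟩
    sum (χ ∘ F)                                                      ≡⟨ sum-combine {m} _ ⟩
    ∑[ g < m ] ∑[ u < b * q ] χ (F (combine g u))                     ≡⟨ sum-cong-≗ {m} (λ g → sum-combine {b} _) ⟩
    ∑[ g < m ] ∑[ l < b ] ∑[ j < q ] χ (F (vertex g l j))             ≡⟨ sum-cong-≗ {m} (λ g → sum-cong-≗ {b} (λ l → sym (count≡sum (λ j → F (vertex g l j))))) ⟩
    ∑[ g < m ] ∑[ l < b ] count (λ j → F (vertex g l j))              ∎

  arcs-into : ∀ x (S : Fin m → Bool) →
              count (λ z → arc x z ∧ S (point z)) ≡ ∑[ p < m ] (χ (S p) * incidences (point x) p)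
  arcs-into x S = begin
    count (λ z → arc x z ∧ S (point z))
      ≡⟨ count-vertices _ ⟩
    ∑[ p < m ] ∑[ l < b ] count (λ j → arc x (vertex p l j) ∧ S (point (vertex p l j)))
      ≡⟨ sum-cong-≗ (λ p → sum-cong-≗ (λ l → count-cong (λ j →
           cong₂ (λ C p′ → lookup C (point x) ∧ S p′) (block-vertex p l j) (point-vertex p l j)))) ⟩
    ∑[ p < m ] ∑[ l < b ] count (λ j → lookup (B p l j) (point x) ∧ S p)
      ≡⟨ sum-cong-≗ {m} (λ p → sum-cong-≗ {b} (λ l → count-∧-const (λ j → lookup (B p l j) (point x)) (S p))) ⟩
    ∑[ p < m ] ∑[ l < b ] (χ (S p) * count (λ j → lookup (B p l j) (point x)))
      ≡⟨ sum-cong-≗ {m} (λ p → sym (*-distribˡ-sum {b} (χ (S p)) _)) ⟩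
    ∑[ p < m ] (χ (S p) * incidences (point x) p)
      ∎

  -- Each point of block y is the point of exactly bq vertices.
  arcs-from : ∀ y → count (λ x → arc x y) ≡ b * q * count (lookup (block y))
  arcs-from y = begin
    count (λ x → arc x y)
      ≡⟨ count-vertices _ ⟩
    ∑[ p < m ] ∑[ l < b ] count (λ j → lookup (block y) (point (vertex p l j)))
      ≡⟨ sum-cong-≗ (λ p → sum-cong-≗ (λ l → count-cong (λ j → cong (lookup (block y)) (point-vertex p l j)))) ⟩
    ∑[ p < m ] ∑[ l < b ] count {q} (λ _ → lookup (block y) p)
      ≡⟨ sum-cong-≗ {m} (λ p → sum-cong-≗ {b} (λ l → count-const q _)) ⟩
    ∑[ p < m ] ∑[ l < b ] (q * χ (lookup (block y) p))
      ≡⟨ sum-cong-≗ {m} (λ p → trans (sum-const b _) (sym (*-assoc b q _))) ⟩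
    ∑[ p < m ] (b * q * χ (lookup (block y) p))
      ≡⟨ sym (*-distribˡ-sum {m} (b * q) _) ⟩
    b * q * sum (χ ∘ lookup (block y))
      ≡⟨ cong (b * q *_) (sym (count≡sum (lookup (block y)))) ⟩
    b * q * count (lookup (block y))
      ∎

  module Blocks (partsInGroups : ∀ h i → P h i ⊆ groupOf grp h)
                (XsInGroups : ∀ g l → X g l ⊆ (groupOf grp (grp g) - g)) where

    part-group : ∀ {h j x} → lookup (P h j) x ≡ true → grp x ≡ h
    part-group {h} {j} {x} e =
      ≟⇒≡ (trans (sym (lookup-groupOf h x)) (⊆⇒lookup (partsInGroups h j) e))

    part-outside : ∀ {h j x} → ¬ grp x ≡ h → lookup (P h j) x ≡ false
    part-outside ne = ¬-not (ne ∘ part-group)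

    X-member : ∀ {g l x} → lookup (X g l) x ≡ true → inGroup (grp g) x ∧ not (lookup ⁅ g ⁆ x) ≡ true
    X-member {g} {l} {x} e = begin
      inGroup (grp g) x ∧ not (lookup ⁅ g ⁆ x)                 ≡⟨ cong (_∧ _) (sym (lookup-groupOf (grp g) x)) ⟩
      lookup (groupOf grp (grp g)) x ∧ not (lookup ⁅ g ⁆ x)    ≡⟨ sym (lookup-─ (groupOf grp (grp g)) ⁅ g ⁆ x) ⟩
      lookup (groupOf grp (grp g) - g) x                       ≡⟨ ⊆⇒lookup (XsInGroups g l) e ⟩
      true                                                     ∎

    X-outside : ∀ {g l x} → ¬ grp x ≡ grp g → lookup (X g l) x ≡ false
    X-outside ne = ¬-not (λ e → ne (≟⇒≡ (∧-conicalˡ _ _ (X-member e))))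

    X-avoids : ∀ g l → lookup (X g l) g ≡ false
    X-avoids g l = ¬-not (λ e →
      contradiction (trans (cong not (sym ([]=⇒lookup (x∈⁅x⁆ g)))) (∧-conicalʳ _ _ (X-member e))) λ ())

    lookup-blockB : ∀ j x → lookup (blockB P j) x ≡ lookup (P (grp x) j) x
    lookup-blockB j x with lookup (P (grp x) j) x in e
    ... | true  = trans (lookup-⋃ (λ h → P h j) (allFin r) x) (any-true _ (∈-allFin (grp x)) e)
    ... | false = trans (lookup-⋃ (λ h → P h j) (allFin r) x) (any-false _ (allFin r) absent)
      where
      absent : ∀ h → lookup (P h j) x ≡ false
      absent h with grp x ≟ h
      ... | yes refl = e
      ... | no  ne   = part-outside ne

    lookup-B : ∀ p l j x →
      lookup (B p l j) x ≡ lookup (X p l) x ∨ (lookup (P (grp x) j) x ∧ not (lookup (P (grp p) j) x))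
    lookup-B p l j x =
      trans (lookup-zipWith _∨_ x (X p l) _)
            (cong (lookup (X p l) x ∨_)
                  (trans (lookup-─ (blockB P j) (P (grp p) j) x)
                         (cong (_∧ not (lookup (P (grp p) j) x)) (lookup-blockB j x))))

    B-ownGroup : ∀ p l j x → grp x ≡ grp p → lookup (B p l j) x ≡ lookup (X p l) x
    B-ownGroup p l j x same = begin
      lookup (B p l j) x                                                    ≡⟨ lookup-B p l j x ⟩
      lookup (X p l) x ∨ (lookup (P (grp x) j) x ∧ not (lookup (P (grp p) j) x))
        ≡⟨ cong (λ h → lookup (X p l) x ∨ (lookup (P h j) x ∧ not (lookup (P (grp p) j) x))) same ⟩
      lookup (X p l) x ∨ (lookup (P (grp p) j) x ∧ not (lookup (P (grp p) j) x))
        ≡⟨ cong (lookup (X p l) x ∨_) (∧-inverseʳ (lookup (P (grp p) j) x)) ⟩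
      lookup (X p l) x ∨ false                                              ≡⟨ ∨-identityʳ _ ⟩
      lookup (X p l) x                                                      ∎

    B-otherGroup : ∀ p l j x → ¬ grp x ≡ grp p → lookup (B p l j) x ≡ lookup (P (grp x) j) x
    B-otherGroup p l j x other
      rewrite lookup-B p l j x | X-outside {p} {l} other | part-outside {grp p} {j} other =
      ∧-identityʳ _

    B-avoids : ∀ g l j → lookup (B g l j) g ≡ false
    B-avoids g l j = trans (B-ownGroup g l j g refl) (X-avoids g l)

    loopless : ∀ w → arc w w ≡ false
    loopless w = B-avoids (point w) (proj₁ (label w)) (proj₂ (label w))

    block-meets-group : ∀ {a} → (∀ h i → ∣ P h i ∣ ≡ a) → (∀ g l → ∣ X g l ∣ ≡ a) →
                        ∀ g l j h → count (λ x → lookup (B g l j) x ∧ inGroup h x) ≡ a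
    block-meets-group partSize XSize g l j h with h ≟ grp g
    ... | yes refl =
      trans (count-within-group _ (lookup (X g l)) (grp g) (B-ownGroup g l j) (λ x → X-outside))
            (trans (sym (card≡count (X g l))) (XSize g l))
    ... | no h≢grp-g =
      trans (count-within-group _ (lookup (P h j)) h inOtherGroup (λ x → part-outside))
            (trans (sym (card≡count (P h j))) (partSize h j))
      where
      inOtherGroup : ∀ x → grp x ≡ h → lookup (B g l j) x ≡ lookup (P h j) x
      inOtherGroup x refl = B-otherGroup g l j x h≢grp-g

    block-size : ∀ {a} → (∀ h i → ∣ P h i ∣ ≡ a) → (∀ g l → ∣ X g l ∣ ≡ a) →
                 ∀ g l j → count (lookup (B g l j)) ≡ r * a
    block-size {a} partSize XSize g l j =
      trans (count-fibres grp _)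
            (trans (sum-cong-≗ (block-meets-group partSize XSize g l j)) (sum-const r a))

    -- In-degree: block y has ra points, each the point of bq vertices.
    in-degree : ∀ {a} → (∀ h i → ∣ P h i ∣ ≡ a) → (∀ g l → ∣ X g l ∣ ≡ a) →
                ∀ y → count (λ x → arc x y) ≡ b * q * (r * a)
    in-degree partSize XSize y =
      trans (arcs-from y)
            (cong (b * q *_) (block-size partSize XSize (point y) (proj₁ (label y)) (proj₂ (label y))))

    incidences-own : ∀ g p → grp p ≡ grp g → incidences g p ≡ q * count (λ l → lookup (X p l) g)
    incidences-own g p same =
      trans (sum-cong-≗ (λ l → count-cong (λ j → B-ownGroup p l j g (sym same))))
            (count-sum-const q (λ l → lookup (X p l) g))

    -- N(g , g) = 0, since g ∉ X_{gl}.
    incidences-self : ∀ g → incidences g g ≡ 0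
    incidences-self g =
      trans (incidences-own g g refl)
            (trans (cong (q *_) (count-none _ (X-avoids g))) (*-zeroʳ q))

    module Incidences {a : ℕ}
      (partsRegular : ∀ h x → x ∈ groupOf grp h → count (λ i → lookup (P h i) x) ≡ a)
      (XsDisjoint : ∀ g l l′ → ¬ l ≡ l′ → X g l ∩ X g l′ ≡ ⊥)
      (XsCover : ∀ g x → x ∈ groupOf grp (grp g) → ¬ x ≡ g → ∃[ l ] x ∈ X g l) where

      X-disjoint-at : ∀ {p l l′ x} → ¬ l ≡ l′ → lookup (X p l′) x ≡ true → lookup (X p l) x ≡ false
      X-disjoint-at {p} {l} {l′} {x} ne x∈X′ = begin
        lookup (X p l) x                          ≡⟨ sym (∧-identityʳ _) ⟩
        lookup (X p l) x ∧ true                   ≡⟨ cong (lookup (X p l) x ∧_) (sym x∈X′) ⟩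
        lookup (X p l) x ∧ lookup (X p l′) x      ≡⟨ sym (lookup-zipWith _∧_ x (X p l) (X p l′)) ⟩
        lookup (X p l ∩ X p l′) x                 ≡⟨ cong (λ S → lookup S x) (XsDisjoint p l l′ ne) ⟩
        lookup ⊥ x                                ≡⟨ lookup-replicate x false ⟩
        false                                     ∎

      X-unique : ∀ g p → grp p ≡ grp g → ¬ p ≡ g → count (λ l → lookup (X p l) g) ≡ 1
      X-unique g p same p≢g with XsCover p g (∈group (sym same)) (p≢g ∘ sym)
      ... | l₀ , g∈X₀ =
        trans (count-point _ l₀ (λ l ne → X-disjoint-at ne ([]=⇒lookup g∈X₀)))
              (cong χ ([]=⇒lookup g∈X₀))

      incidences-sameGroup : ∀ g p → grp p ≡ grp g → ¬ p ≡ g → incidences g p ≡ q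
      incidences-sameGroup g p same p≢g =
        trans (incidences-own g p same) (trans (cong (q *_) (X-unique g p same p≢g)) (*-identityʳ q))

      incidences-otherGroup : ∀ g p → ¬ grp p ≡ grp g → incidences g p ≡ b * a
      incidences-otherGroup g p other = begin
        ∑[ l < b ] count (λ j → lookup (B p l j) g)
          ≡⟨ sum-cong-≗ {b} (λ l → count-cong (λ j → B-otherGroup p l j g (other ∘ sym))) ⟩
        ∑[ l < b ] count (λ j → lookup (P (grp g) j) g)
          ≡⟨ sum-cong-≗ {b} (λ _ → partsRegular (grp g) g (∈group refl)) ⟩
        ∑[ l < b ] a
          ≡⟨ sum-const b a ⟩
        b * a
          ∎

      weighted-incidences : ∀ (S : Fin m → Bool) g →
        ∑[ p < m ] (χ (S p) * incidences g p) ≡ q * count (nearby S g) + b * a * count (elsewhere S g)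
      weighted-incidences S g = begin
        ∑[ p < m ] (χ (S p) * incidences g p)                        ≡⟨ sum-cong-≗ {m} term ⟩
        ∑[ p < m ] (q * χ (near p) + b * a * χ (far p))              ≡⟨ ∑-distrib-+ {m} (λ p → q * χ (near p)) _ ⟩
        ∑[ p < m ] (q * χ (near p)) + ∑[ p < m ] (b * a * χ (far p))
          ≡⟨ sym (cong₂ _+_ (*-distribˡ-sum {m} q (χ ∘ near)) (*-distribˡ-sum {m} (b * a) (χ ∘ far))) ⟩
        q * sum (χ ∘ near) + b * a * sum (χ ∘ far)
          ≡⟨ sym (cong₂ (λ u v → q * u + b * a * v) (count≡sum near) (count≡sum far)) ⟩
        q * count near + b * a * count far                           ∎
        where
        near far : Fin m → Bool
        near = nearby S g
        far = elsewhere S g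

        noWeight : ∀ x y → 0 ≡ x * 0 + y * 0
        noWeight = solve-∀
        firstWeight : ∀ x y → x ≡ x * 1 + y * 0
        firstWeight = solve-∀
        secondWeight : ∀ x y → y ≡ x * 0 + y * 1
        secondWeight = solve-∀

        term : ∀ p → χ (S p) * incidences g p ≡ q * χ (near p) + b * a * χ (far p)
        term p with S p
        ... | false = noWeight q (b * a)
        ... | true with grp p ≟ grp g | p ≟ g
        ... | yes _    | yes refl = trans (+-identityʳ _) (trans (incidences-self g) (noWeight q (b * a)))
        ... | yes same | no  p≢g  =
          trans (+-identityʳ _) (trans (incidences-sameGroup g p same p≢g) (firstWeight q (b * a)))
        ... | no other | _        =
          trans (+-identityʳ _) (trans (incidences-otherGroup g p other) (secondWeight q (b * a)))

      paths-profile : ∀ (S : Fin m → Bool) g →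
        ∑[ p < m ] (χ (S p) * incidences g p)
          ≡ q * (count (inGroupOf S g) ∸ χ (S g)) + b * a * (count S ∸ count (inGroupOf S g))
      paths-profile S g =
        trans (weighted-incidences S g) (sym (cong₂ (λ u v → q * u + b * a * v) nearCount farCount))
        where
        nearCount : count (inGroupOf S g) ∸ χ (S g) ≡ count (nearby S g)
        nearCount = trans (cong (_∸ χ (S g)) (point-in-group S g)) (m+n∸m≡n (χ (S g)) (count (nearby S g)))
        farCount : count S ∸ count (inGroupOf S g) ≡ count (elsewhere S g)
        farCount = trans (cong (_∸ count (inGroupOf S g)) (count-split S (inGroup (grp g))))
                         (m+n∸m≡n (count (inGroupOf S g)) (count (elsewhere S g)))

      -- Out-degree: take S = all points; G_{grp g} has q points, the point set m.
      out-degree : (∀ h → ∣ groupOf grp h ∣ ≡ q) → ∀ x → count (arc x) ≡ q * (q ∸ 1) + b * a * (m ∸ q)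
      out-degree groupSize x = begin
        count (λ z → arc x z)                  ≡⟨ count-cong (λ z → sym (∧-identityʳ (arc x z))) ⟩
        count (λ z → arc x z ∧ true)           ≡⟨ arcs-into x (λ _ → true) ⟩
        ∑[ p < m ] (χ true * incidences g p)   ≡⟨ paths-profile (λ _ → true) g ⟩
        q * (count (inGroup (grp g)) ∸ 1) + b * a * (count {m} (λ _ → true) ∸ count (inGroup (grp g)))
          ≡⟨ cong₂ (λ u v → q * (u ∸ 1) + b * a * (v ∸ u)) (groupCount (grp g)) everything ⟩
        q * (q ∸ 1) + b * a * (m ∸ q)          ∎
        where
        g = point x
        groupCount : ∀ h → count (inGroup h) ≡ q
        groupCount h = trans (count-cong (λ x → sym (lookup-groupOf h x)))
                             (trans (sym (card≡count (groupOf grp h))) (groupSize h))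
        everything : count {m} (λ _ → true) ≡ m
        everything = trans (count-const m true) (*-identityʳ m)

      -- 2-paths from x to y: take S = block y, which meets G_{grp (point x)} in a points.
      two-paths : (∀ h i → ∣ P h i ∣ ≡ a) → (∀ g l → ∣ X g l ∣ ≡ a) →
        ∀ x y → count (λ z → arc x z ∧ arc z y) ≡ q * (a ∸ χ (arc x y)) + b * a * (r * a ∸ a)
      two-paths partSize XSize x y = begin
        count (λ z → arc x z ∧ arc z y)                  ≡⟨ arcs-into x S ⟩
        ∑[ p < m ] (χ (S p) * incidences (point x) p)    ≡⟨ paths-profile S (point x) ⟩
        q * (count (inGroupOf S (point x)) ∸ χ (arc x y)) + b * a * (count S ∸ count (inGroupOf S (point x)))
          ≡⟨ cong₂ (λ u v → q * (u ∸ χ (arc x y)) + b * a * (v ∸ u))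
                   (block-meets-group partSize XSize (point y) l j (grp (point x)))
                   (block-size partSize XSize (point y) l j) ⟩
        q * (a ∸ χ (arc x y)) + b * a * (r * a ∸ a)      ∎
        where
        S = lookup (block y)
        l = proj₁ (label y)
        j = proj₂ (label y)

-- The theorem: each field of IsDSRG is one of the counts above followed by an
-- arithmetic identity.
mainTheorem2 : (r q a b : ℕ) → ⦃ _ : NonZero a ⦄ →
    1 < r → 1 < q → 1 < a → 1 < b → q ∸ 1 ≡ a * b →
    (grp : Fin (r * q) → Fin r) →
    (∀ h → ∣ groupOf grp h ∣ ≡ q) →
    (P : Fin r → Fin q → Subset (r * q)) →
    (∀ h i → P h i ⊆ groupOf grp h) →
    (∀ h i → ∣ P h i ∣ ≡ a) →
    (∀ h i i′ → P h i ≡ P h i′ → i ≡ i′) →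
    (∀ h x → x ∈ groupOf grp h → count (λ i → lookup (P h i) x) ≡ a) →
    (X : Fin (r * q) → Fin b → Subset (r * q)) →
    (∀ g l → X g l ⊆ (groupOf grp (grp g) - g)) →
    (∀ g l → ∣ X g l ∣ ≡ a) →
    (∀ g l l′ → ¬ l ≡ l′ → X g l ∩ X g l′ ≡ ⊥) →
    (∀ g x → x ∈ groupOf grp (grp g) → ¬ x ≡ g → ∃[ l ] x ∈ X g l) →
    IsDSRG (r * q * (b * q)) (arcD grp P X)
    ((r * q ^ 2 * (q ∸ 1)) / a)
    (r * q * (q ∸ 1))
    (r * (q ∸ 1) * a + a)
    (q * (a ∸ 1) + (r ∸ 1) * (q ∸ 1) * a)
    (r * (q ∸ 1) * a + a)
mainTheorem2 r q a b 1<r 1<q _ _ q-1≡ab grp groupSize P partsInGroups partSize _ partsRegular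
             X XsInGroups XSize XsDisjoint XsCover = record
  { order       = order-arith r q a b q-1≡ab
  ; loopless    = loopless
  ; outDegree   = λ x → trans (out-degree groupSize x) (out-degree-arith r q a b 0<r 0<q q-1≡ab)
  ; inDegree    = λ y → trans (in-degree partSize XSize y) (in-degree-arith r q a b q-1≡ab)
  ; diagonal    = λ x → nonadjacent x x (loopless x)
  ; adjacent    = λ x y _ x→y → trans (two-paths partSize XSize x y)
                                  (trans (cong (λ c → q * (a ∸ χ c) + _) x→y) (adjacent-arith r q a b 0<r q-1≡ab))
  ; nonadjacent = λ x y _ → nonadjacent x y
  }
  where
  open Construction grp P X
  open Blocks partsInGroups XsInGroups
  open Incidences partsRegular XsDisjoint XsCover

  0<r : 0 < r
  0<r = <⇒≤ 1<r
  0<q : 0 < q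
  0<q = <⇒≤ 1<q

  nonadjacent : ∀ x y → arc x y ≡ false → count (λ z → arc x z ∧ arc z y) ≡ r * (q ∸ 1) * a + a
  nonadjacent x y x↛y = trans (two-paths partSize XSize x y)
                           (trans (cong (λ c → q * (a ∸ χ c) + _) x↛y) (nonadjacent-arith r q a b 0<r 0<q q-1≡ab))
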